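{- Let $T$ be a tree. Then every cycle of $P_2\times T$ is a nice cycle.
   Context: $P_2$ is the path with 2 vertices and $G\times H$ is the Cartesian product of graphs. A cycle $C$ of a graph $G$ is nice if $G-C$ (the subgraph of $G$ induced by the vertices not on $C$) has a perfect matching. -}

module Defs where

open import Level using (0ℓ)
open import Data.Nat using (ℕ; suc; _+_)
open import Data.Fin using (Fin; zero; suc; inject₁; fromℕ)
open import Data.Product using (Σ; ∃; _×_; _,_)
open import Data.Sum using (_⊎_; inj₁; inj₂)
open import Data.Empty using (⊥)
open import Relation.Nullary using (¬_)
open import Relation.Binary.PropositionalEquality using (_≡_; sym)
open import Function.Bundles using (_↔_)
open import Function.Definitions using (Injective)

record Graph : Set₁ where
  field
    V      : Set
    E      : V → V → Set
    E-sym  : ∀ {u v} → E u v → E v u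
    E-irr  : ∀ {v} → ¬ E v v
open Graph public

Finite : Graph → Set
Finite G = Σ ℕ λ n → V G ↔ Fin n

data Walk (G : Graph) : V G → V G → Set where
  []  : ∀ {v} → Walk G v v
  _∷_ : ∀ {u v w} → E G u v → Walk G v w → Walk G u w

Connected : Graph → Set
Connected G = ∀ (u v : V G) → Walk G u v

record Cycle (G : Graph) : Set where
  field
    m      : ℕ
    vtx    : Fin (3 + m) → V G
    inj    : Injective _≡_ _≡_ vtx
    step   : ∀ (i : Fin (2 + m)) → E G (vtx (inject₁ i)) (vtx (suc i))
    close  : E G (vtx (fromℕ (2 + m))) (vtx zero)
open Cycle public

OnCycle : ∀ {G} → Cycle G → V G → Set
OnCycle C v = ∃ λ i → vtx C i ≡ v

Tree : Graph → Set
Tree G = Finite G × Connected G × ¬ Cycle G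

data P₂-Adj : Fin 2 → Fin 2 → Set where
  e01 : P₂-Adj zero (suc zero)
  e10 : P₂-Adj (suc zero) zero

P₂-sym : ∀ {u v} → P₂-Adj u v → P₂-Adj v u
P₂-sym e01 = e10
P₂-sym e10 = e01

P₂-irr : ∀ {v} → ¬ P₂-Adj v v
P₂-irr ()

P₂ : Graph
P₂ = record { V = Fin 2 ; E = P₂-Adj ; E-sym = P₂-sym ; E-irr = P₂-irr }

□-Adj : (G H : Graph) → V G × V H → V G × V H → Set
□-Adj G H (a , b) (c , d) = (E G a c × b ≡ d) ⊎ (a ≡ c × E H b d)

□-sym : (G H : Graph) → ∀ {u v} → □-Adj G H u v → □-Adj G H v u
□-sym G H {a , b} {c , d} (inj₁ (e , p)) = inj₁ (E-sym G e , sym p)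
□-sym G H {a , b} {c , d} (inj₂ (p , e)) = inj₂ (sym p , E-sym H e)

□-irr : (G H : Graph) → ∀ {v} → ¬ □-Adj G H v v
□-irr G H {a , b} (inj₁ (e , _)) = E-irr G e
□-irr G H {a , b} (inj₂ (_ , e)) = E-irr H e

_□_ : Graph → Graph → Graph
G □ H = record { V = V G × V H ; E = □-Adj G H ; E-sym = □-sym G H ; E-irr = □-irr G H }

-- A perfect matching of G - C (the subgraph induced by vertices not on C):
-- a symmetric set M of edges of G, both ends off C, such that every vertex
-- off C lies in exactly one edge of M.
record PerfectMatchingAvoiding (G : Graph) (C : Cycle G) : Set₁ where
  field
    M       : V G → V G → Set
    M-sym   : ∀ {u v} → M u v → M v u
    M-edge  : ∀ {u v} → M u v → E G u v
    M-off   : ∀ {u v} → M u v → ¬ OnCycle C u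
    M-cover : ∀ v → ¬ OnCycle C v →
              Σ (V G) λ u → M v u × (∀ w → M v w → w ≡ u)

Nice : (G : Graph) → Cycle G → Set₁
Nice G C = PerfectMatchingAvoiding G C

{-# OPTIONS --safe #-}
-- If a vertex (a, x) of a cycle C of P₂ □ T had its partner (1 - a, x) off C,
-- then both C-neighbours of (a, x) would lie in layer a, over two distinct
-- neighbours y and z of x in T. The rest of C is a walk between them that avoids
-- the whole fibre over x, so its projection to T is a y–z walk avoiding x, which
-- shortcuts to a path and closes through x to a cycle of T. Hence C is a union of
-- fibres, and the edges (0, x)(1, x) over the remaining x perfectly match
-- (P₂ □ T) - C.
module Submission where

open import Defs
open import Data.Nat as ℕ using (ℕ; suc; _+_)
open import Data.Fin using (Fin; zero; suc; inject₁; fromℕ; opposite)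
open import Data.Fin.Properties using (0≢1+n; fromℕ≢inject₁; inject₁-injective; opposite-involutive; inj⇒≟)
open import Data.Fin.Induction using (>-weakInduction)
open import Data.List using (List; []; _∷_; tabulate)
open import Data.List.Membership.Propositional using (_∈_)
import Data.List.Membership.DecPropositional as DecMembership
open import Data.List.Relation.Unary.All as All using (All; []; _∷_)
open import Data.List.Relation.Unary.All.Properties using (tabulate⁺; anti-mono; ¬Any⇒All¬)
open import Data.List.Relation.Unary.Any using (here; there)
open import Data.List.Relation.Unary.AllPairs using ([]; _∷_)
open import Data.List.Relation.Unary.Unique.Propositional using (Unique)
open import Data.List.Relation.Binary.Subset.Propositional using (_⊆_)
open import Data.Product using (Σ; ∃; _×_; _,_; proj₁; proj₂)
open import Data.Sum using (_⊎_; inj₁; inj₂)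
open import Data.Empty using (⊥-elim)
open import Function using (_∘_; id)
open import Function.Definitions using (Injective)
open import Function.Properties.Inverse using (↔⇒↣)
open import Relation.Nullary using (¬_; yes; no)
open import Relation.Binary.Definitions using (DecidableEquality)
open import Relation.Binary.PropositionalEquality using (_≡_; _≢_; refl; sym; trans; cong; cong₂; subst)

module _ {G : Graph} where

  vertices : ∀ {u v} → Walk G u v → List (V G)
  vertices {u} []      = u ∷ []
  vertices {u} (_ ∷ w) = u ∷ vertices w

  length : ∀ {u v} → Walk G u v → ℕ
  length []      = 0
  length (_ ∷ w) = suc (length w)

  vertexAt : ∀ {u v} (w : Walk G u v) → Fin (suc (length w)) → V G
  vertexAt {u} w       zero    = u
  vertexAt     (_ ∷ w) (suc i) = vertexAt w i

  vertexAt-∈ : ∀ {u v} (w : Walk G u v) i → vertexAt w i ∈ vertices w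
  vertexAt-∈ []      zero    = here refl
  vertexAt-∈ (_ ∷ w) zero    = here refl
  vertexAt-∈ (_ ∷ w) (suc i) = there (vertexAt-∈ w i)

  vertexAt-step : ∀ {u v} (w : Walk G u v) (i : Fin (length w)) →
                  E G (vertexAt w (inject₁ i)) (vertexAt w (suc i))
  vertexAt-step (e ∷ w) zero    = e
  vertexAt-step (_ ∷ w) (suc i) = vertexAt-step w i

  vertexAt-last : ∀ {u v} (w : Walk G u v) → vertexAt w (fromℕ (length w)) ≡ v
  vertexAt-last []      = refl
  vertexAt-last (_ ∷ w) = vertexAt-last w

  vertexAt-injective : ∀ {u v} (w : Walk G u v) → Unique (vertices w) → Injective _≡_ _≡_ (vertexAt w)
  vertexAt-injective w       _              {zero}  {zero}  _  = refl
  vertexAt-injective (_ ∷ w) (u∉w ∷ _)      {zero}  {suc j} eq = ⊥-elim (All.lookup u∉w (vertexAt-∈ w j) eq)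
  vertexAt-injective (_ ∷ w) (u∉w ∷ _)      {suc i} {zero}  eq = ⊥-elim (All.lookup u∉w (vertexAt-∈ w i) (sym eq))
  vertexAt-injective (_ ∷ w) (_ ∷ unique-w) {suc i} {suc j} eq = cong suc (vertexAt-injective w unique-w eq)

  walkAlong : ∀ {n} (f : Fin (suc n) → V G) → (∀ i → E G (f (inject₁ i)) (f (suc i))) →
              Walk G (f zero) (f (fromℕ n))
  walkAlong {ℕ.zero} f step = []
  walkAlong {suc n}  f step = step zero ∷ walkAlong (f ∘ suc) (step ∘ suc)

  vertices-walkAlong : ∀ {n} (f : Fin (suc n) → V G) step → vertices (walkAlong f step) ≡ tabulate f
  vertices-walkAlong {ℕ.zero} f step = refl
  vertices-walkAlong {suc n}  f step = cong (f zero ∷_) (vertices-walkAlong (f ∘ suc) (step ∘ suc))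

  dropUntil : ∀ {u v x} (w : Walk G u v) → x ∈ vertices w → Unique (vertices w) →
              Σ (Walk G x v) λ p → Unique (vertices p) × vertices p ⊆ vertices w
  dropUntil []      (here refl) unique-w       = [] , unique-w , id
  dropUntil (e ∷ w) (here refl) unique-w       = e ∷ w , unique-w , id
  dropUntil (_ ∷ w) (there x∈w) (_ ∷ unique-w) with dropUntil w x∈w unique-w
  ... | p , unique-p , p⊆w = p , unique-p , there ∘ p⊆w

  closePath : ∀ {x y z w} (e : E G x y) (f : E G y z) (p : Walk G z w) →
              Unique (vertices (e ∷ f ∷ p)) → E G w x → Cycle G
  closePath {x} {w = w} e f p unique back = record
    { m     = length p
    ; vtx   = vertexAt q
    ; inj   = vertexAt-injective q unique
    ; step  = vertexAt-step q
    ; close = subst (λ t → E G t _) (sym (vertexAt-last q)) back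
    }
    where
      q : Walk G x w
      q = e ∷ f ∷ p

  module _ (_≟_ : DecidableEquality (V G)) where
    open DecMembership _≟_ using (_∈?_)

    shortcut : ∀ {u v} (w : Walk G u v) → Σ (Walk G u v) λ p → Unique (vertices p) × vertices p ⊆ vertices w
    shortcut []          = [] , [] ∷ [] , id
    shortcut {u} (e ∷ w) with shortcut w
    ... | p , unique-p , p⊆w with u ∈? vertices p
    ...   | yes u∈p = let q , unique-q , q⊆p = dropUntil p u∈p unique-p
                      in  q , unique-q , there ∘ p⊆w ∘ q⊆p
    ...   | no  u∉p = e ∷ p , ¬Any⇒All¬ _ u∉p ∷ unique-p ,
                      λ { (here eq) → here eq ; (there x∈p) → there (p⊆w x∈p) }

    avoiding-walk⇒cycle : ∀ {x y z} → E G x y → E G x z → y ≢ z →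
                          (w : Walk G y z) → All (x ≢_) (vertices w) → Cycle G
    avoiding-walk⇒cycle x~y x~z y≢z w x∉w with shortcut w
    ... | []    , _        , _   = ⊥-elim (y≢z refl)
    ... | e ∷ p , unique-p , p⊆w = closePath x~y e p (anti-mono p⊆w x∉w ∷ unique-p) (E-sym G x~z)

  -- Cycle with its length as a parameter, so that the induction in detour can
  -- range over all cycles of one length.
  record IsCycle {m : ℕ} (f : Fin (3 + m) → V G) : Set where
    field
      injective : Injective _≡_ _≡_ f
      step-adj  : ∀ i → E G (f (inject₁ i)) (f (suc i))
      close-adj : E G (f (fromℕ (2 + m))) (f zero)

  isCycle : (C : Cycle G) → IsCycle (vtx C)
  isCycle C = record { injective = inj C ; step-adj = step C ; close-adj = close C }

  rotate : ∀ {n} → Fin (suc n) → Fin (suc n)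
  rotate zero    = fromℕ _
  rotate (suc i) = inject₁ i

  rotate-injective : ∀ {n} → Injective _≡_ _≡_ (rotate {n})
  rotate-injective {x = zero}  {zero}  _  = refl
  rotate-injective {x = zero}  {suc j} eq = ⊥-elim (fromℕ≢inject₁ eq)
  rotate-injective {x = suc i} {zero}  eq = ⊥-elim (fromℕ≢inject₁ (sym eq))
  rotate-injective {x = suc i} {suc j} eq = cong suc (inject₁-injective eq)

  rotate-isCycle : ∀ {m} {f : Fin (3 + m) → V G} → IsCycle f → IsCycle (f ∘ rotate)
  rotate-isCycle {m} c = record
    { injective = rotate-injective ∘ injective
    ; step-adj  = λ { zero → close-adj ; (suc i) → step-adj (inject₁ i) }
    ; close-adj = step-adj (fromℕ (1 + m))
    }
    where open IsCycle c

  record Detour {n} (f : Fin n → V G) (v : V G) : Set where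
    field
      start end : Fin n
      start≢end : f start ≢ f end
      start-adj : E G v (f start)
      end-adj   : E G v (f end)
      walk      : Walk G (f start) (f end)
      avoids    : All (λ u → (∃ λ i → f i ≡ u) × u ≢ v) (vertices walk)

  detour-reindex : ∀ {m n} {f : Fin n → V G} {v} (g : Fin m → Fin n) → Detour (f ∘ g) v → Detour f v
  detour-reindex g d = record
    { start     = g start
    ; end       = g end
    ; start≢end = start≢end
    ; start-adj = start-adj
    ; end-adj   = end-adj
    ; walk      = walk
    ; avoids    = All.map (λ { ((i , eq) , u≢v) → (g i , eq) , u≢v }) avoids
    }
    where open Detour d

  detour-last : ∀ {m} {f : Fin (3 + m) → V G} → IsCycle f → Detour f (f (fromℕ (2 + m)))
  detour-last {m} {f} c = record
    { start     = zero
    ; end       = inject₁ (fromℕ (1 + m))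
    ; start≢end = 0≢1+n ∘ injective
    ; start-adj = close-adj
    ; end-adj   = E-sym G (step-adj (fromℕ (1 + m)))
    ; walk      = walkAlong (f ∘ inject₁) (step-adj ∘ inject₁)
    ; avoids    = subst (All _) (sym (vertices-walkAlong (f ∘ inject₁) (step-adj ∘ inject₁)))
                    (tabulate⁺ λ i → (inject₁ i , refl) , fromℕ≢inject₁ ∘ sym ∘ injective)
    }
    where open IsCycle c

  -- Rotation moves the vertex at index inject₁ j to index suc j, so downward
  -- induction from the last index reaches every vertex.
  detour : ∀ {m} {f : Fin (3 + m) → V G} → IsCycle f → ∀ i → Detour f (f i)
  detour c i = >-weakInduction (λ j → ∀ {g} → IsCycle g → Detour g (g j))
                 detour-last
                 (λ j detour-suc d → detour-reindex rotate (detour-suc (rotate-isCycle d)))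
                 i c

module _ {G H : Graph} where

  project₂ : ∀ {u v} → Walk (G □ H) u v → Walk H (proj₂ u) (proj₂ v)
  project₂ []                                                 = []
  project₂ (_∷_ {u = _ , x} {v = _ , .x} (inj₁ (_ , refl)) w) = project₂ w
  project₂ (inj₂ (_ , e) ∷ w)                                 = e ∷ project₂ w

  All-project₂ : ∀ {P : V H → Set} {u v} (w : Walk (G □ H) u v) →
                 All (P ∘ proj₂) (vertices w) → All P (vertices (project₂ w))
  All-project₂ []                                                 (pu ∷ []) = pu ∷ []
  All-project₂ (_∷_ {u = _ , x} {v = _ , .x} (inj₁ (_ , refl)) w) (_ ∷ pw)  = All-project₂ w pw
  All-project₂ (inj₂ (_ , e) ∷ w)                                 (pu ∷ pw) = pu ∷ All-project₂ w pw

module _ (T : Graph) where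

  partner : V (P₂ □ T) → V (P₂ □ T)
  partner (a , x) = opposite a , x

  partner-involutive : ∀ v → partner (partner v) ≡ v
  partner-involutive (a , x) = cong (_, x) (opposite-involutive a)

  partner-adj : ∀ v → E (P₂ □ T) v (partner v)
  partner-adj (zero , x)     = inj₁ (e01 , refl)
  partner-adj (suc zero , x) = inj₁ (e10 , refl)

  same-fibre : ∀ {u v : V (P₂ □ T)} → proj₂ u ≡ proj₂ v → u ≡ v ⊎ u ≡ partner v
  same-fibre {zero , x}     {zero , .x}     refl = inj₁ refl
  same-fibre {zero , x}     {suc zero , .x} refl = inj₂ refl
  same-fibre {suc zero , x} {zero , .x}     refl = inj₂ refl
  same-fibre {suc zero , x} {suc zero , .x} refl = inj₁ refl

  adj⇒partner⊎sameLayer : ∀ {v u} → E (P₂ □ T) v u →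
                          u ≡ partner v ⊎ (proj₁ u ≡ proj₁ v × E T (proj₂ v) (proj₂ u))
  adj⇒partner⊎sameLayer {_ , x} {_ , .x} (inj₁ (e01 , refl)) = inj₁ refl
  adj⇒partner⊎sameLayer {_ , x} {_ , .x} (inj₁ (e10 , refl)) = inj₁ refl
  adj⇒partner⊎sameLayer (inj₂ (refl , e))                     = inj₂ (refl , e)

  module _ (_≟_ : DecidableEquality (V T)) (acyclic : ¬ Cycle T) (C : Cycle (P₂ □ T)) where

    partner-off-cycle : ∀ {v} → ¬ OnCycle C (partner v) → ¬ OnCycle C v
    partner-off-cycle lonely (i , refl) =
      acyclic (avoiding-walk⇒cycle _≟_ v~y v~z y≢z (project₂ walk) (All-project₂ walk (All.map off-fibre avoids)))
      where
        open Detour (detour (isCycle C) i)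

        v : V (P₂ □ T)
        v = vtx C i

        sameLayer-neighbour : ∀ j → E (P₂ □ T) v (vtx C j) →
                              proj₁ (vtx C j) ≡ proj₁ v × E T (proj₂ v) (proj₂ (vtx C j))
        sameLayer-neighbour j e with adj⇒partner⊎sameLayer e
        ... | inj₁ eq        = ⊥-elim (lonely (j , eq))
        ... | inj₂ sameLayer = sameLayer

        off-fibre : ∀ {u} → OnCycle C u × u ≢ v → proj₂ v ≢ proj₂ u
        off-fibre (on , u≢v) eq with same-fibre (sym eq)
        ... | inj₁ u≡v  = u≢v u≡v
        ... | inj₂ refl = lonely on

        v~y : E T (proj₂ v) (proj₂ (vtx C start))
        v~y = proj₂ (sameLayer-neighbour start start-adj)

        v~z : E T (proj₂ v) (proj₂ (vtx C end))
        v~z = proj₂ (sameLayer-neighbour end end-adj)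

        y≢z : proj₂ (vtx C start) ≢ proj₂ (vtx C end)
        y≢z eq = start≢end (cong₂ _,_ (trans (proj₁ (sameLayer-neighbour start start-adj))
                                             (sym (proj₁ (sameLayer-neighbour end end-adj)))) eq)

    partnerMatching : Nice (P₂ □ T) C
    partnerMatching = record
      { M       = λ u w → ¬ OnCycle C u × w ≡ partner u
      ; M-sym   = λ { {u} (off , refl) →
                      partner-off-cycle (subst (¬_ ∘ OnCycle C) (sym (partner-involutive u)) off) ,
                      sym (partner-involutive u) }
      ; M-edge  = λ { {u} (_ , refl) → partner-adj u }
      ; M-off   = proj₁
      ; M-cover = λ u off → partner u , (off , refl) , λ _ → proj₂
      }

lemma4 : (T : Graph) → Tree T → (C : Cycle (P₂ □ T)) → Nice (P₂ □ T) C
lemma4 T ((_ , V≅Fin) , _ , acyclic) = partnerMatching T (inj⇒≟ (↔⇒↣ V≅Fin)) acyclic
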